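{- Let $n\ge1$, let $m$ be a complex number, and let $U_0=0$, $U_1=1$, $U_{e+1}=mU_e+U_{e-1}$. Then: (1) for all $1\le i\le n$, $\displaystyle\sum_{j=1}^n(-1)^{n+1-j}m^{i+j-n-1}\binom{i-1}{n-j}U_{n-j}=U_{i-1}$; (2) for all $1\le i\le n$, $\displaystyle\sum_{j=1}^n\sum_{k=1}^n(-1)^{n+1-j}m^{i+j+2k-2n-2}\binom{i-1}{n-k}\binom{k-1}{n-j}U_{n-j}=U_{n+i-2}$; (3) for all integers $l\ge1$, $p\ge0$, $\displaystyle\sum_{j=1}^nU_{l-1}^{n-j}U_l^{j-1}U_{(n-1)p+j-1}\binom{n-1}{j-1}=U_{(n-1)(l+p)}$; (4) if $n\ge2$, then for all integers $l\ge2$, $p\ge0$ with $U_{l-1}U_l\neq0$, \[\sum_{j=1}^nU_{(n-1)p+j-1}U_{l-1}^{n-j-1}U_l^{j-2}\left[U_l^2\binom{n-1}{j-1}+(-1)^l\binom{n-2}{j-2}\right]=U_{(n-1)(l+p)+1}.\]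
   Context: Binomial coefficients $\binom{a}{b}$ are $0$ when $b<0$ or $b>a$; a product $m^{k}\binom{a}{b}$ with vanishing binomial coefficient is read as $0$ (when the binomial coefficient is nonzero the exponent of $m$ is nonnegative). $0^0=1$. -}

module Defs where

open import Level using (Level; _⊔_) renaming (suc to lsuc)
open import Algebra.Bundles using (CommutativeRing)
open import Relation.Nullary using (¬_)
open import Data.Nat using (ℕ; zero; suc)
open import Data.Nat.Combinatorics using (_C_)
open import Data.Integer using (ℤ; +_; -[1+_])

record Field (c ℓ : Level) : Set (lsuc (c ⊔ ℓ)) where
  field
    commutativeRing : CommutativeRing c ℓ
  open CommutativeRing commutativeRing public
  field
    inv     : (x : Carrier) → ¬ (x ≈ 0#) → Carrier
    inverse : (x : Carrier) (nz : ¬ (x ≈ 0#)) → (x * inv x nz) ≈ 1#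
    0≉1     : ¬ (0# ≈ 1#)

module FieldDefs {c ℓ : Level} (F : Field c ℓ) where
  open Field F

  pow : Carrier → ℕ → Carrier
  pow x zero    = 1#
  pow x (suc k) = x * pow x k

  fromℕ : ℕ → Carrier
  fromℕ zero    = 0#
  fromℕ (suc k) = 1# + fromℕ k

  zpow : (x : Carrier) → ¬ (x ≈ 0#) → ℤ → Carrier
  zpow x nz (+ k)      = pow x k
  zpow x nz -[1+ k ]   = pow (inv x nz) (suc k)

  -- binomial coefficient with integer lower index: 0 when b < 0
  -- (and 0 when b > a, as for stdlib's _C_)
  binomℤ : ℕ → ℤ → ℕ
  binomℤ a (+ b)     = a C b
  binomℤ a -[1+ b ]  = 0

  -- the product m^k * binom(a,b) with k : ℤ, read as 0 when k < 0
  -- (by the paper's convention the binomial coefficient vanishes then)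
  mPowBinom : Carrier → ℤ → ℕ → ℕ → Carrier
  mPowBinom m (+ k)    a b = pow m k * fromℕ (a C b)
  mPowBinom m -[1+ k ] a b = 0#

  Σ1 : ℕ → (ℕ → Carrier) → Carrier
  Σ1 zero    f = 0#
  Σ1 (suc n) f = Σ1 n f + f (suc n)

  U : Carrier → ℕ → Carrier
  U m zero          = 0#
  U m (suc zero)    = 1#
  U m (suc (suc e)) = m * U m (suc e) + U m e

  nz-left : (a b : Carrier) → ¬ ((a * b) ≈ 0#) → ¬ (a ≈ 0#)
  nz-left a b h a≈0 = h (trans (*-congʳ a≈0) (zeroˡ b))

  nz-right : (a b : Carrier) → ¬ ((a * b) ≈ 0#) → ¬ (b ≈ 0#)
  nz-right a b h b≈0 = h (trans (*-congˡ b≈0) (zeroʳ a))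

module Submission where

-- Write E for the shift f ↦ f ∘ suc on sequences, so that E² = mE + 1 on U.  Each sum is a
-- binomial expansion of an operator applied to U, read off at one index:
-- (1) (m − E)ᵃ = (−E⁻¹)ᵃ, (2) (1 + mE)ᵃ = E²ᵃ together with (1), (3) (U_l E + U_{l−1})ᵃ = E^{la}
-- by the addition formula, and (4) reduces to (3) after multiplying by U_{l−1}, by d'Ocagne's
-- identity U_{l−1} U_{Y+l} = U_l U_{Y+l−1} + (−1)ˡ U_Y.  The expansions are all instances of one
-- lemma: any τ with τ (a + 1) = (αE + β) (τ a) is the binomial sum Σ C(a,t) αᵗ β^{a−t} (τ 0 ∘ Eᵗ).

open import Defs
open import Level using (Level)
open import Relation.Nullary using (¬_; yes; no)
open import Data.Product using (_×_; _,_)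
open import Data.Nat as ℕ using (ℕ; zero; suc; _≤_; _<_; z≤n; s≤s; _∸_) renaming (_+_ to _+ℕ_; _*_ to _*ℕ_)
import Data.Nat.Properties as ℕ
import Data.Nat.Tactic.RingSolver as ℕ-Tactic
open import Data.Nat.Combinatorics using (_C_; k>n⇒nCk≡0; nCk+nC[k+1]≡[n+1]C[k+1]; nCk≡nC[n∸k])
open import Data.Integer as ℤ using (ℤ; +_; -[1+_]; 1ℤ; _⊖_; _◃_; sign; ∣_∣) renaming (_+_ to _+ℤ_; _-_ to _-ℤ_)
import Data.Integer.Properties as ℤ
open import Data.Integer.Tactic.RingSolver using (solve-∀)
open import Data.Sign as Sign using (Sign)
open import Data.Maybe using (Maybe; just; nothing)
open import Relation.Binary.PropositionalEquality as ≡ using (_≡_)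
open import Algebra.Bundles using (CommutativeRing)
import Algebra.Solver.Ring
open import Algebra.Solver.Ring.AlmostCommutativeRing using (fromCommutativeRing; _-Raw-AlmostCommutative⟶_)

module IntegerCoefficientSolver {c ℓ : Level} (R : CommutativeRing c ℓ) where
  open CommutativeRing R
  open import Algebra.Properties.Ring ring using (-0#≈0#; -‿involutive; -1*x≈-x)
  open import Algebra.Properties.AbelianGroup +-abelianGroup using (⁻¹-∙-comm)
  open import Algebra.Properties.CommutativeSemigroup +-commutativeSemigroup
    using () renaming (interchange to +-interchange)
  open import Algebra.Properties.CommutativeSemigroup *-commutativeSemigroup
    using () renaming (interchange to *-interchange)
  open import Algebra.Properties.Semiring.Mult.TCOptimised semiring
    using (1+×; ×-homo-+; ×1-homo-*) renaming (_×_ to _×′_)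
  open import Relation.Binary.Reasoning.Setoid setoid

  -- The optimised multiple makes fromℤ 0, fromℤ 1 and fromℤ -1 reduce to 0#, 1# and - 1#,
  -- so that solver constants match the goal definitionally.
  fromℤ : ℤ → Carrier
  fromℤ (+ n)      = n ×′ 1#
  fromℤ (-[1+ n ]) = - (suc n ×′ 1#)

  fromSign : Sign → Carrier
  fromSign Sign.+ = 1#
  fromSign Sign.- = - 1#

  fromℤ-⊖ : ∀ a b → fromℤ (a ⊖ b) ≈ a ×′ 1# - b ×′ 1#
  fromℤ-⊖ zero    zero    = sym (trans (+-congˡ -0#≈0#) (+-identityʳ 0#))
  fromℤ-⊖ zero    (suc b) = sym (+-identityˡ _)
  fromℤ-⊖ (suc a) zero    = sym (trans (+-congˡ -0#≈0#) (+-identityʳ _))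
  fromℤ-⊖ (suc a) (suc b) = begin
    fromℤ (suc a ⊖ suc b)              ≡⟨ ≡.cong fromℤ (ℤ.[1+m]⊖[1+n]≡m⊖n a b) ⟩
    fromℤ (a ⊖ b)                      ≈⟨ fromℤ-⊖ a b ⟩
    a ×′ 1# - b ×′ 1#                  ≈⟨ +-identityˡ _ ⟨
    0# + (a ×′ 1# - b ×′ 1#)           ≈⟨ +-congʳ (-‿inverseʳ 1#) ⟨
    (1# - 1#) + (a ×′ 1# - b ×′ 1#)    ≈⟨ +-interchange _ _ _ _ ⟩
    (1# + a ×′ 1#) + (- 1# - b ×′ 1#)  ≈⟨ +-cong (1+× a 1#) (trans (-‿cong (1+× b 1#)) (sym (⁻¹-∙-comm _ _))) ⟨
    suc a ×′ 1# - suc b ×′ 1#          ∎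

  fromℤ-◃ : ∀ s n → fromℤ (s ◃ n) ≈ fromSign s * (n ×′ 1#)
  fromℤ-◃ s      zero    = sym (zeroʳ _)
  fromℤ-◃ Sign.+ (suc n) = sym (*-identityˡ _)
  fromℤ-◃ Sign.- (suc n) = sym (-1*x≈-x _)

  fromSign-* : ∀ s t → fromSign (s Sign.* t) ≈ fromSign s * fromSign t
  fromSign-* Sign.+ t      = sym (*-identityˡ _)
  fromSign-* Sign.- Sign.+ = sym (*-identityʳ _)
  fromSign-* Sign.- Sign.- = sym (trans (-1*x≈-x (- 1#)) (-‿involutive 1#))

  fromℤ-+ : ∀ i j → fromℤ (i ℤ.+ j) ≈ fromℤ i + fromℤ j
  fromℤ-+ (+ a)    (+ b)    = ×-homo-+ 1# a b
  fromℤ-+ (+ a)    -[1+ b ] = fromℤ-⊖ a (suc b)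
  fromℤ-+ -[1+ a ] (+ b)    = trans (fromℤ-⊖ b (suc a)) (+-comm _ _)
  fromℤ-+ -[1+ a ] -[1+ b ] = begin
    - (suc (suc (a +ℕ b)) ×′ 1#)       ≡⟨ ≡.cong (λ k → - (suc k ×′ 1#)) (ℕ.+-suc a b) ⟨
    - ((suc a +ℕ suc b) ×′ 1#)         ≈⟨ -‿cong (×-homo-+ 1# (suc a) (suc b)) ⟩
    - (suc a ×′ 1# + suc b ×′ 1#)      ≈⟨ ⁻¹-∙-comm _ _ ⟨
    - (suc a ×′ 1#) + - (suc b ×′ 1#)  ∎

  fromℤ-* : ∀ i j → fromℤ (i ℤ.* j) ≈ fromℤ i * fromℤ j
  fromℤ-* i j = begin
    fromℤ ((sign i Sign.* sign j) ◃ (∣ i ∣ *ℕ ∣ j ∣))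
      ≈⟨ fromℤ-◃ (sign i Sign.* sign j) (∣ i ∣ *ℕ ∣ j ∣) ⟩
    fromSign (sign i Sign.* sign j) * ((∣ i ∣ *ℕ ∣ j ∣) ×′ 1#)
      ≈⟨ *-cong (fromSign-* (sign i) (sign j)) (×1-homo-* ∣ i ∣ ∣ j ∣) ⟩
    (fromSign (sign i) * fromSign (sign j)) * ((∣ i ∣ ×′ 1#) * (∣ j ∣ ×′ 1#))
      ≈⟨ *-interchange _ _ _ _ ⟩
    (fromSign (sign i) * (∣ i ∣ ×′ 1#)) * (fromSign (sign j) * (∣ j ∣ ×′ 1#))
      ≈⟨ *-cong (fromℤ-◃ (sign i) ∣ i ∣) (fromℤ-◃ (sign j) ∣ j ∣) ⟨
    fromℤ (sign i ◃ ∣ i ∣) * fromℤ (sign j ◃ ∣ j ∣)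
      ≡⟨ ≡.cong₂ (λ x y → fromℤ x * fromℤ y) (ℤ.◃-inverse i) (ℤ.◃-inverse j) ⟩
    fromℤ i * fromℤ j ∎

  fromℤ-neg : ∀ i → fromℤ (ℤ.- i) ≈ - fromℤ i
  fromℤ-neg (+ zero)  = sym -0#≈0#
  fromℤ-neg (+ suc n) = refl
  fromℤ-neg -[1+ n ]  = sym (-‿involutive _)

  homomorphism : ℤ.+-*-rawRing -Raw-AlmostCommutative⟶ fromCommutativeRing R
  homomorphism = record
    { ⟦_⟧    = fromℤ
    ; +-homo = fromℤ-+
    ; *-homo = fromℤ-*
    ; -‿homo = fromℤ-neg
    ; 0-homo = refl
    ; 1-homo = refl
    }

  fromℤ-≟ : ∀ i j → Maybe (fromℤ i ≈ fromℤ j)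
  fromℤ-≟ i j with i ℤ.≟ j
  ... | yes ≡.refl = just refl
  ... | no _       = nothing

  open Algebra.Solver.Ring ℤ.+-*-rawRing (fromCommutativeRing R) homomorphism fromℤ-≟ public

+m-+n≡+[m∸n] : ∀ {m n} → n ≤ m → + m -ℤ + n ≡ + (m ∸ n)
+m-+n≡+[m∸n] {m} {n} n≤m = ≡.trans (ℤ.[+m]-[+n]≡m⊖n m n) (ℤ.⊖-≥ n≤m)

+m-[+n-+o]≡+[m∸[n∸o]] : ∀ {m n o} → o ≤ n → n ∸ o ≤ m → + m -ℤ (+ n -ℤ + o) ≡ + (m ∸ (n ∸ o))
+m-[+n-+o]≡+[m∸[n∸o]] {m} o≤n n∸o≤m = ≡.trans (≡.cong (+ m -ℤ_) (+m-+n≡+[m∸n] o≤n)) (+m-+n≡+[m∸n] n∸o≤m)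

alternating-exponent : ∀ {a n j} → j ≤ n → n ∸ j ≤ a →
  (((+ suc a) +ℤ (+ j)) -ℤ (+ n)) -ℤ (+ 1) ≡ + (a ∸ (n ∸ j))
alternating-exponent {a} {n} {j} j≤n n∸j≤a =
  ≡.trans (regroup (+ a) (+ j) (+ n)) (+m-[+n-+o]≡+[m∸[n∸o]] j≤n n∸j≤a)
  where
    regroup : ∀ a j n → ((1ℤ +ℤ a +ℤ j) -ℤ n) -ℤ 1ℤ ≡ a -ℤ (n -ℤ j)
    regroup = solve-∀

double-exponent : ∀ {a n j k} → j ≤ n → suc k ≤ n → n ∸ suc k ≤ a → n ∸ j ≤ k →
  (((+ suc a) +ℤ (+ j)) +ℤ (+ (2 *ℕ suc k))) -ℤ (+ ((2 *ℕ n) +ℕ 2)) ≡ + ((a ∸ (n ∸ suc k)) +ℕ (k ∸ (n ∸ j)))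
double-exponent {a} {n} {j} {k} j≤n k<n n∸k≤a n∸j≤k = begin
  ((+ suc a +ℤ + j) +ℤ + (2 *ℕ suc k)) -ℤ + (2 *ℕ n +ℕ 2)
    ≡⟨ ≡.cong₂ (λ x y → ((+ suc a +ℤ + j) +ℤ x) -ℤ y) (ℤ.pos-* 2 (suc k))
               (≡.trans (ℤ.pos-+ (2 *ℕ n) 2) (≡.cong (_+ℤ + 2) (ℤ.pos-* 2 n))) ⟩
  ((+ suc a +ℤ + j) +ℤ + 2 ℤ.* + suc k) -ℤ (+ 2 ℤ.* + n +ℤ + 2)
    ≡⟨ regroup (+ a) (+ j) (+ k) (+ n) ⟩
  (+ a -ℤ (+ n -ℤ + suc k)) +ℤ (+ k -ℤ (+ n -ℤ + j))
    ≡⟨ ≡.cong₂ _+ℤ_ (+m-[+n-+o]≡+[m∸[n∸o]] k<n n∸k≤a) (+m-[+n-+o]≡+[m∸[n∸o]] j≤n n∸j≤k) ⟩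
  + ((a ∸ (n ∸ suc k)) +ℕ (k ∸ (n ∸ j))) ∎
  where
    open ≡.≡-Reasoning
    regroup : ∀ a j k n → ((1ℤ +ℤ a +ℤ j) +ℤ + 2 ℤ.* (1ℤ +ℤ k)) -ℤ (+ 2 ℤ.* n +ℤ + 2)
                          ≡ (a -ℤ (n -ℤ (1ℤ +ℤ k))) +ℤ (k -ℤ (n -ℤ j))
    regroup = solve-∀

module _ {c ℓ : Level} (F : Field c ℓ) where
  open Field F
  open FieldDefs F
  open import Algebra.Properties.Ring ring using (-0#≈0#)
  open IntegerCoefficientSolver commutativeRing using (solve; _:=_; con; _:+_; _:*_; _:-_; :-_)
  open import Relation.Binary.Reasoning.Setoid setoid
  open import Algebra.Properties.CommutativeSemigroup +-commutativeSemigroup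
    using () renaming (interchange to +-interchange)

  Σ1-cong : ∀ n {f g : ℕ → Carrier} → (∀ j → 1 ≤ j → j ≤ n → f j ≈ g j) → Σ1 n f ≈ Σ1 n g
  Σ1-cong zero    f≈g = refl
  Σ1-cong (suc n) f≈g =
    +-cong (Σ1-cong n (λ j 1≤j j≤n → f≈g j 1≤j (ℕ.m≤n⇒m≤1+n j≤n))) (f≈g (suc n) (s≤s z≤n) ℕ.≤-refl)

  Σ1-zero : ∀ n {f : ℕ → Carrier} → (∀ j → 1 ≤ j → j ≤ n → f j ≈ 0#) → Σ1 n f ≈ 0#
  Σ1-zero n f≈0 = trans (Σ1-cong n f≈0) (Σ1-const0 n)
    where
      Σ1-const0 : ∀ n → Σ1 n (λ _ → 0#) ≈ 0#
      Σ1-const0 zero    = refl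
      Σ1-const0 (suc n) = trans (+-identityʳ _) (Σ1-const0 n)

  Σ1-+ : ∀ n (f g : ℕ → Carrier) → Σ1 n (λ j → f j + g j) ≈ Σ1 n f + Σ1 n g
  Σ1-+ zero    f g = sym (+-identityʳ 0#)
  Σ1-+ (suc n) f g = trans (+-congʳ (Σ1-+ n f g)) (+-interchange _ _ _ _)

  Σ1-*ˡ : ∀ n x (f : ℕ → Carrier) → Σ1 n (λ j → x * f j) ≈ x * Σ1 n f
  Σ1-*ˡ zero    x f = sym (zeroʳ x)
  Σ1-*ˡ (suc n) x f = trans (+-congʳ (Σ1-*ˡ n x f)) (sym (distribˡ x _ _))

  Σ1-suc : ∀ n (f : ℕ → Carrier) → Σ1 (suc n) f ≈ f 1 + Σ1 n (λ j → f (suc j))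
  Σ1-suc zero    f = trans (+-identityˡ _) (sym (+-identityʳ _))
  Σ1-suc (suc n) f = trans (+-congʳ (Σ1-suc n f)) (+-assoc _ _ _)

  Σ1-+ℕ : ∀ a b (f : ℕ → Carrier) → Σ1 (a +ℕ b) f ≈ Σ1 a f + Σ1 b (λ j → f (a +ℕ j))
  Σ1-+ℕ a zero    f rewrite ℕ.+-identityʳ a = sym (+-identityʳ _)
  Σ1-+ℕ a (suc b) f rewrite ℕ.+-suc a b     = trans (+-congʳ (Σ1-+ℕ a b f)) (+-assoc _ _ _)

  Σ1-comm : ∀ n k (f : ℕ → ℕ → Carrier) → Σ1 n (λ j → Σ1 k (f j)) ≈ Σ1 k (λ i → Σ1 n (λ j → f j i))
  Σ1-comm zero    k f = sym (Σ1-zero k (λ _ _ _ → refl))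
  Σ1-comm (suc n) k f = trans (+-congʳ (Σ1-comm n k f)) (sym (Σ1-+ k _ _))

  Σ1-reverse : ∀ n (f : ℕ → Carrier) → Σ1 n (λ j → f (n ∸ j)) ≈ Σ1 n (λ j → f (j ∸ 1))
  Σ1-reverse zero    f = refl
  Σ1-reverse (suc n) f = begin
    Σ1 n (λ j → f (suc n ∸ j)) + f (n ∸ n)  ≈⟨ +-cong (Σ1-cong n (λ j _ j≤n → reflexive (≡.cong f (ℕ.+-∸-assoc 1 j≤n))))
                                                       (reflexive (≡.cong f (ℕ.n∸n≡0 n))) ⟩
    Σ1 n (λ j → f (suc (n ∸ j))) + f 0      ≈⟨ +-congʳ (Σ1-reverse n (λ t → f (suc t))) ⟩
    Σ1 n (λ j → f (suc (j ∸ 1))) + f 0      ≈⟨ +-congʳ (Σ1-cong n (λ { (suc j) _ _ → refl })) ⟩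
    Σ1 n f + f 0                            ≈⟨ +-comm _ _ ⟩
    f 0 + Σ1 n f                            ≈⟨ Σ1-suc n (λ j → f (j ∸ 1)) ⟨
    Σ1 (suc n) (λ j → f (j ∸ 1))            ∎

  fromℕ-+ : ∀ a b → fromℕ (a +ℕ b) ≈ fromℕ a + fromℕ b
  fromℕ-+ zero    b = sym (+-identityˡ _)
  fromℕ-+ (suc a) b = trans (+-congˡ (fromℕ-+ a b)) (sym (+-assoc _ _ _))

  fromℕ-C-vanish : ∀ {a b} → a < b → fromℕ (a C b) ≈ 0#
  fromℕ-C-vanish a<b = reflexive (≡.cong fromℕ (k>n⇒nCk≡0 a<b))

  pow-+ : ∀ x a b → pow x (a +ℕ b) ≈ pow x a * pow x b
  pow-+ x zero    b = sym (*-identityˡ _)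
  pow-+ x (suc a) b = trans (*-congˡ (pow-+ x a b)) (sym (*-assoc _ _ _))

  pow-1# : ∀ k → pow 1# k ≈ 1#
  pow-1# zero    = refl
  pow-1# (suc k) = trans (*-identityˡ _) (pow-1# k)

  module BinomialShift (α β : Carrier) (g : ℕ → Carrier) where

    binomialTerm : ℕ → ℕ → ℕ → Carrier
    binomialTerm a N t = fromℕ (a C t) * (pow α t * (pow β (a ∸ t) * g (N +ℕ t)))

    -- For a < K this is ((αE + β)^a g) N, where E is the shift g ↦ g ∘ suc.
    binomialSum : ℕ → ℕ → ℕ → Carrier
    binomialSum a K N = Σ1 K (λ j → binomialTerm a N (j ∸ 1))

    binomialTerm-zero : ∀ a N → binomialTerm (suc a) N 0 ≈ β * binomialTerm a N 0
    binomialTerm-zero a N =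
      solve 3 (λ b bᵃ G → (con (+ 1) :+ con (+ 0)) :* (con (+ 1) :* ((b :* bᵃ) :* G))
                          := b :* ((con (+ 1) :+ con (+ 0)) :* (con (+ 1) :* (bᵃ :* G))))
              refl β (pow β a) (g (N +ℕ 0))

    binomialTerm-pascal : ∀ a N t →
      binomialTerm (suc a) N (suc t) ≈ α * binomialTerm a (suc N) t + β * binomialTerm a N (suc t)
    binomialTerm-pascal a N t = begin
      fromℕ (suc a C suc t) * ((α * αᵗ) * (b * g (N +ℕ suc t)))
        ≈⟨ *-cong (trans (reflexive (≡.cong fromℕ (≡.sym (nCk+nC[k+1]≡[n+1]C[k+1] a t)))) (fromℕ-+ (a C t) (a C suc t)))
                  (*-congˡ (*-congˡ (reflexive (≡.cong g (ℕ.+-suc N t))))) ⟩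
      (c₀ + c₁) * ((α * αᵗ) * (b * G))
        ≈⟨ solve 6 (λ a c₀ c₁ aᵗ b G → (c₀ :+ c₁) :* ((a :* aᵗ) :* (b :* G))
                                       := a :* (c₀ :* (aᵗ :* (b :* G))) :+ (c₁ :* b) :* (a :* (aᵗ :* G)))
                   refl α c₀ c₁ αᵗ b G ⟩
      α * (c₀ * (αᵗ * (b * G))) + (c₁ * b) * (α * (αᵗ * G))
        ≈⟨ +-congˡ (*-congʳ C-suc*pow) ⟩
      α * (c₀ * (αᵗ * (b * G))) + (β * (c₁ * b′)) * (α * (αᵗ * G))
        ≈⟨ +-congˡ (solve 6 (λ β c₁ b′ a aᵗ G → (β :* (c₁ :* b′)) :* (a :* (aᵗ :* G))
                                              := β :* (c₁ :* ((a :* aᵗ) :* (b′ :* G))))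
                            refl β c₁ b′ α αᵗ G) ⟩
      α * (c₀ * (αᵗ * (b * G))) + β * (c₁ * ((α * αᵗ) * (b′ * G)))
        ≈⟨ +-congˡ (*-congˡ (*-congˡ (*-congˡ (*-congˡ (reflexive (≡.cong g (≡.sym (ℕ.+-suc N t)))))))) ⟩
      α * binomialTerm a (suc N) t + β * binomialTerm a N (suc t) ∎
      where
        c₀ = fromℕ (a C t)
        c₁ = fromℕ (a C suc t)
        αᵗ = pow α t
        b  = pow β (a ∸ t)
        b′ = pow β (a ∸ suc t)
        G  = g (suc N +ℕ t)
        C-suc*pow : c₁ * b ≈ β * (c₁ * b′)
        C-suc*pow with suc t ℕ.≤? a
        ... | yes t<a = trans (*-congˡ (reflexive (≡.cong (pow β) (ℕ.+-∸-assoc 1 t<a))))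
                              (solve 3 (λ c₁ β b′ → c₁ :* (β :* b′) := β :* (c₁ :* b′)) refl c₁ β b′)
        ... | no  t≮a = begin
          c₁ * b         ≈⟨ *-congʳ c₁≈0 ⟩
          0# * b         ≈⟨ solve 3 (λ b β b′ → con (+ 0) :* b := β :* (con (+ 0) :* b′)) refl b β b′ ⟩
          β * (0# * b′)  ≈⟨ *-congˡ (*-congʳ c₁≈0) ⟨
          β * (c₁ * b′)  ∎
          where c₁≈0 = fromℕ-C-vanish (ℕ.≰⇒> t≮a)

    binomialSum-suc : ∀ a K N → binomialSum (suc a) (suc K) N ≈ α * binomialSum a K (suc N) + β * binomialSum a (suc K) N
    binomialSum-suc a K N = begin
      binomialSum (suc a) (suc K) N
        ≈⟨ Σ1-suc K _ ⟩
      binomialTerm (suc a) N 0 + Σ1 K (binomialTerm (suc a) N)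
        ≈⟨ +-cong (binomialTerm-zero a N) (Σ1-cong K (λ { (suc t) _ _ → binomialTerm-pascal a N t })) ⟩
      β * t₀ + Σ1 K (λ j → α * binomialTerm a (suc N) (j ∸ 1) + β * binomialTerm a N j)
        ≈⟨ +-congˡ (trans (Σ1-+ K _ _) (+-cong (Σ1-*ˡ K α _) (Σ1-*ˡ K β _))) ⟩
      β * t₀ + (α * binomialSum a K (suc N) + β * S)
        ≈⟨ solve 4 (λ β t₀ A S → β :* t₀ :+ (A :+ β :* S) := A :+ β :* (t₀ :+ S))
                   refl β t₀ (α * binomialSum a K (suc N)) S ⟩
      α * binomialSum a K (suc N) + β * (t₀ + S)
        ≈⟨ +-congˡ (*-congˡ (Σ1-suc K _)) ⟨
      α * binomialSum a K (suc N) + β * binomialSum a (suc K) N ∎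
      where
        t₀ = binomialTerm a N 0
        S  = Σ1 K (binomialTerm a N)

    binomialSum≈ : (τ : ℕ → ℕ → Carrier) → (∀ N → τ 0 N ≈ g N) →
                   (∀ a N → τ (suc a) N ≈ α * τ a (suc N) + β * τ a N) →
                   ∀ a K N → a < K → binomialSum a K N ≈ τ a N
    binomialSum≈ τ τ₀ τ-suc zero (suc K) N _ = begin
      binomialSum 0 (suc K) N
        ≈⟨ Σ1-suc K _ ⟩
      binomialTerm 0 N 0 + Σ1 K (binomialTerm 0 N)
        ≈⟨ +-cong (solve 1 (λ G → (con (+ 1) :+ con (+ 0)) :* (con (+ 1) :* (con (+ 1) :* G)) := G) refl (g (N +ℕ 0)))
                  (Σ1-zero K (λ { (suc t) _ _ → zeroˡ _ })) ⟩
      g (N +ℕ 0) + 0#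
        ≈⟨ +-identityʳ _ ⟩
      g (N +ℕ 0)
        ≈⟨ trans (reflexive (≡.cong g (ℕ.+-identityʳ N))) (sym (τ₀ N)) ⟩
      τ 0 N ∎
    binomialSum≈ τ τ₀ τ-suc (suc a) (suc K) N (s≤s a<K) = begin
      binomialSum (suc a) (suc K) N
        ≈⟨ binomialSum-suc a K N ⟩
      α * binomialSum a K (suc N) + β * binomialSum a (suc K) N
        ≈⟨ +-cong (*-congˡ (binomialSum≈ τ τ₀ τ-suc a K (suc N) a<K))
                  (*-congˡ (binomialSum≈ τ τ₀ τ-suc a (suc K) N (ℕ.m≤n⇒m≤1+n a<K))) ⟩
      α * τ a (suc N) + β * τ a N
        ≈⟨ τ-suc a N ⟨
      τ (suc a) N ∎

  mPowBinom-vanish : ∀ x z {a b} → a < b → mPowBinom x z a b ≈ 0#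
  mPowBinom-vanish x (+ k)    a<b = trans (*-congˡ (fromℕ-C-vanish a<b)) (zeroʳ _)
  mPowBinom-vanish x -[1+ k ] a<b = refl

  mPowBinom-≈ : ∀ x {z} e a b → (b ≤ a → z ≡ + e) → mPowBinom x z a b ≈ pow x e * fromℕ (a C b)
  mPowBinom-≈ x {z} e a b z≡e with b ℕ.≤? a
  ... | yes b≤a rewrite z≡e b≤a = refl
  ... | no  b≰a = trans (mPowBinom-vanish x z a<b) (sym (trans (*-congˡ (fromℕ-C-vanish a<b)) (zeroʳ _)))
    where a<b = ℕ.≰⇒> b≰a

  mPowBinom-*-fromℕ-C : ∀ x {z} a b d c → (b ≤ a → c ≤ d → z ≡ + ((a ∸ b) +ℕ (d ∸ c))) →
    mPowBinom x z a b * fromℕ (d C c) ≈ (pow x (a ∸ b) * fromℕ (a C b)) * (pow x (d ∸ c) * fromℕ (d C c))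
  mPowBinom-*-fromℕ-C x {z} a b d c z≡e with c ℕ.≤? d
  ... | yes c≤d = begin
    mPowBinom x z a b * fromℕ (d C c)
      ≈⟨ *-congʳ (mPowBinom-≈ x ((a ∸ b) +ℕ (d ∸ c)) a b (λ b≤a → z≡e b≤a c≤d)) ⟩
    pow x ((a ∸ b) +ℕ (d ∸ c)) * fromℕ (a C b) * fromℕ (d C c)
      ≈⟨ *-congʳ (*-congʳ (pow-+ x (a ∸ b) (d ∸ c))) ⟩
    pow x (a ∸ b) * pow x (d ∸ c) * fromℕ (a C b) * fromℕ (d C c)
      ≈⟨ solve 4 (λ p q c₁ c₂ → p :* q :* c₁ :* c₂ := (p :* c₁) :* (q :* c₂)) refl _ _ _ _ ⟩
    (pow x (a ∸ b) * fromℕ (a C b)) * (pow x (d ∸ c) * fromℕ (d C c)) ∎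
  ... | no  c≰d = begin
    mPowBinom x z a b * fromℕ (d C c)           ≈⟨ *-congˡ c₂≈0 ⟩
    mPowBinom x z a b * 0#                      ≈⟨ solve 3 (λ M p q → M :* con (+ 0) := p :* (q :* con (+ 0))) refl _ _ _ ⟩
    (pow x (a ∸ b) * fromℕ (a C b)) * (pow x (d ∸ c) * 0#)
                                                ≈⟨ *-congˡ (*-congˡ c₂≈0) ⟨
    (pow x (a ∸ b) * fromℕ (a C b)) * (pow x (d ∸ c) * fromℕ (d C c)) ∎
    where c₂≈0 = fromℕ-C-vanish (ℕ.≰⇒> c≰d)

  *-cancelˡ-nonzero : ∀ {x a b} → ¬ x ≈ 0# → x * a ≈ x * b → a ≈ b
  *-cancelˡ-nonzero {x} {a} {b} x≉0 xa≈xb = begin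
    a                ≈⟨ *-identityˡ a ⟨
    1# * a           ≈⟨ *-congʳ (trans (*-comm _ _) (inverse x x≉0)) ⟨
    (x⁻¹ * x) * a    ≈⟨ *-assoc _ _ _ ⟩
    x⁻¹ * (x * a)    ≈⟨ *-congˡ xa≈xb ⟩
    x⁻¹ * (x * b)    ≈⟨ *-assoc _ _ _ ⟨
    (x⁻¹ * x) * b    ≈⟨ *-congʳ (trans (*-comm _ _) (inverse x x≉0)) ⟩
    1# * b           ≈⟨ *-identityˡ b ⟩
    b                ∎
    where x⁻¹ = inv x x≉0

  *-zpow-pred : ∀ x (x≉0 : ¬ x ≈ 0#) k → x * zpow x x≉0 (+ k -ℤ + 1) ≈ pow x k
  *-zpow-pred x x≉0 zero    = trans (*-congˡ (*-identityʳ _)) (inverse x x≉0)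
  *-zpow-pred x x≉0 (suc k) = refl

  clear-zpow : ∀ {α β} (α≉0 : ¬ α ≈ 0#) (β≉0 : ¬ β ≈ 0#) n i → suc i ≤ n → ∀ u c₁ s c₂ →
    β * (u * (zpow β β≉0 (((+ n) -ℤ (+ suc i)) -ℤ (+ 1))
       * (zpow α α≉0 ((+ suc i) -ℤ (+ 2)) * ((pow α 2 * c₁) + (s * c₂)))))
      ≈ α * (pow β (n ∸ suc i) * (pow α i * (u * c₁)))
        + s * (u * (pow β (n ∸ suc i) * (zpow α α≉0 ((+ suc i) -ℤ (+ 2)) * c₂)))
  clear-zpow {α} {β} α≉0 β≉0 n i i<n u c₁ s c₂ = begin
    β * (u * (zβ * (zα * ((α * (α * 1#)) * c₁ + s * c₂))))
      ≈⟨ solve 8 (λ β u zβ zα α c₁ s c₂ → β :* (u :* (zβ :* (zα :* ((α :* (α :* con (+ 1))) :* c₁ :+ s :* c₂))))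
                                         := u :* ((β :* zβ) :* (α :* (α :* zα) :* c₁ :+ s :* (zα :* c₂))))
                 refl β u zβ zα α c₁ s c₂ ⟩
    u * ((β * zβ) * (α * (α * zα) * c₁ + s * (zα * c₂)))
      ≈⟨ *-congˡ (*-cong β*zβ≈ (+-congʳ (*-congʳ (*-congˡ α*zα≈)))) ⟩
    u * (pow β (n ∸ suc i) * (α * pow α i * c₁ + s * (zα * c₂)))
      ≈⟨ solve 7 (λ u bⁿ α aⁱ c₁ s z → u :* (bⁿ :* (α :* aⁱ :* c₁ :+ s :* z))
                                       := α :* (bⁿ :* (aⁱ :* (u :* c₁))) :+ s :* (u :* (bⁿ :* z)))
                 refl u (pow β (n ∸ suc i)) α (pow α i) c₁ s (zα * c₂) ⟩
    α * (pow β (n ∸ suc i) * (pow α i * (u * c₁))) + s * (u * (pow β (n ∸ suc i) * (zα * c₂))) ∎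
    where
      zβ = zpow β β≉0 (((+ n) -ℤ (+ suc i)) -ℤ (+ 1))
      zα = zpow α α≉0 ((+ suc i) -ℤ (+ 2))
      β*zβ≈ : β * zβ ≈ pow β (n ∸ suc i)
      β*zβ≈ = trans (*-congˡ (reflexive (≡.cong (λ e → zpow β β≉0 (e -ℤ + 1)) (+m-+n≡+[m∸n] i<n))))
                    (*-zpow-pred β β≉0 (n ∸ suc i))
      α*zα≈ : α * zα ≈ pow α i
      α*zα≈ = trans (*-congˡ (reflexive (≡.cong (zpow α α≉0) (ℤ.[1+m]⊖[1+n]≡m⊖n i 1))))
                    (*-zpow-pred α α≉0 i)

  module LucasSequence (m : Carrier) where

    IsLucas : (ℕ → Carrier) → Set ℓ
    IsLucas f = ∀ x → f (suc (suc x)) ≈ m * f (suc x) + f x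

    U-isLucas : IsLucas (U m)
    U-isLucas x = refl

    U-+-isLucas : ∀ k → IsLucas (λ x → U m (x +ℕ k))
    U-+-isLucas k x = refl

    isLucas-suc : ∀ {f} → IsLucas f → IsLucas (λ x → f (suc x))
    isLucas-suc f-rec x = f-rec (suc x)

    isLucas-*ˡ : ∀ {f} a → IsLucas f → IsLucas (λ x → a * f x)
    isLucas-*ˡ {f} a f-rec x = trans (*-congˡ (f-rec x))
      (solve 4 (λ a m f₁ f₀ → a :* (m :* f₁ :+ f₀) := m :* (a :* f₁) :+ a :* f₀) refl a m (f (suc x)) (f x))

    isLucas-+ : ∀ {f g} → IsLucas f → IsLucas g → IsLucas (λ x → f x + g x)
    isLucas-+ {f} {g} f-rec g-rec x = trans (+-cong (f-rec x) (g-rec x))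
      (solve 5 (λ m f₁ f₀ g₁ g₀ → (m :* f₁ :+ f₀) :+ (m :* g₁ :+ g₀) := m :* (f₁ :+ g₁) :+ (f₀ :+ g₀))
             refl m (f (suc x)) (f x) (g (suc x)) (g x))

    isLucas-unique : ∀ {f g} → IsLucas f → IsLucas g → f 0 ≈ g 0 → f 1 ≈ g 1 → ∀ x → f x ≈ g x
    isLucas-unique f-rec g-rec e₀ e₁ zero          = e₀
    isLucas-unique f-rec g-rec e₀ e₁ (suc zero)    = e₁
    isLucas-unique f-rec g-rec e₀ e₁ (suc (suc x)) =
      trans (f-rec x) (trans (+-cong (*-congˡ (isLucas-unique f-rec g-rec e₀ e₁ (suc x)))
                                     (isLucas-unique f-rec g-rec e₀ e₁ x))
                             (sym (g-rec x)))

    U-+ : ∀ l x → U m (x +ℕ suc l) ≈ U m (suc l) * U m (suc x) + U m l * U m x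
    U-+ l = isLucas-unique (U-+-isLucas (suc l))
      (isLucas-+ (isLucas-*ˡ (U m (suc l)) (isLucas-suc U-isLucas)) (isLucas-*ˡ (U m l) U-isLucas))
      (solve 2 (λ u₁ u₀ → u₁ := u₁ :* con (+ 1) :+ u₀ :* con (+ 0)) refl (U m (suc l)) (U m l))
      (solve 3 (λ m u₁ u₀ → m :* u₁ :+ u₀ := u₁ :* (m :* con (+ 1) :+ con (+ 0)) :+ u₀ :* con (+ 1))
               refl m (U m (suc l)) (U m l))

    cassini : ∀ L → U m L * U m (suc (suc L)) ≈ U m (suc L) * U m (suc L) + pow (- 1#) (suc L)
    cassini zero = solve 1 (λ m → con (+ 0) :* (m :* con (+ 1) :+ con (+ 0))
                                  := con (+ 1) :* con (+ 1) :+ con -[1+ 0 ] :* con (+ 1)) refl m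
    cassini (suc L) = begin
      u₁ * (m * u₂ + u₁)
        ≈⟨ solve 3 (λ m u₀ u₁ → u₁ :* (m :* (m :* u₁ :+ u₀) :+ u₁)
                                := (m :* u₁ :+ u₀) :* (m :* u₁ :+ u₀) :+ con -[1+ 0 ] :* (u₀ :* (m :* u₁ :+ u₀) :- u₁ :* u₁))
                   refl m u₀ u₁ ⟩
      u₂ * u₂ + - 1# * (u₀ * u₂ - u₁ * u₁)
        ≈⟨ +-congˡ (*-congˡ (+-congʳ (cassini L))) ⟩
      u₂ * u₂ + - 1# * ((u₁ * u₁ + s) - u₁ * u₁)
        ≈⟨ solve 4 (λ u₂ u₁ s o → u₂ :* u₂ :+ o :* ((u₁ :* u₁ :+ s) :- u₁ :* u₁) := u₂ :* u₂ :+ o :* s)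
                   refl u₂ u₁ s (- 1#) ⟩
      u₂ * u₂ + - 1# * s ∎
      where
        u₀ = U m L
        u₁ = U m (suc L)
        u₂ = U m (suc (suc L))
        s  = pow (- 1#) (suc L)

    dOcagne : ∀ L Y → U m L * U m (Y +ℕ suc L) ≈ U m (suc L) * U m (Y +ℕ L) + pow (- 1#) (suc L) * U m Y
    dOcagne L = isLucas-unique (isLucas-*ˡ (U m L) (U-+-isLucas (suc L)))
      (isLucas-+ (isLucas-*ˡ (U m (suc L)) (U-+-isLucas L)) (isLucas-*ˡ (pow (- 1#) (suc L)) U-isLucas))
      (solve 3 (λ u₀ u₁ s → u₀ :* u₁ := u₁ :* u₀ :+ s :* con (+ 0)) refl (U m L) (U m (suc L)) (pow (- 1#) (suc L)))
      (trans (cassini L) (+-congˡ (sym (*-identityʳ _))))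

    -- V a N is ((m − E)^a U) N for the shift E; since E² = mE + 1, m − E = −E⁻¹,
    -- so V a N = (−1)^a U_{N−a} with U extended to negative indices.
    V : ℕ → ℕ → Carrier
    V zero    N = U m N
    V (suc a) N = - 1# * V a (suc N) + m * V a N

    V-isLucas : ∀ a → IsLucas (V a)
    V-isLucas zero    = U-isLucas
    V-isLucas (suc a) = isLucas-+ (isLucas-*ˡ (- 1#) (isLucas-suc (V-isLucas a))) (isLucas-*ˡ m (V-isLucas a))

    V-suc-suc : ∀ a N → V (suc a) (suc N) ≈ - V a N
    V-suc-suc a N = trans (+-congʳ (*-congˡ (V-isLucas a N)))
      (solve 3 (λ m v₀ v₁ → con -[1+ 0 ] :* (m :* v₁ :+ v₀) :+ m :* v₁ := :- v₀) refl m (V a N) (V a (suc N)))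

    V-zero : ∀ a → V a 0 ≈ - U m a
    V-zero zero          = sym -0#≈0#
    V-zero (suc zero)    = solve 1 (λ m → con -[1+ 0 ] :* con (+ 1) :+ m :* con (+ 0) := :- con (+ 1)) refl m
    V-zero (suc (suc a)) = begin
      - 1# * V (suc a) 1 + m * V (suc a) 0
        ≈⟨ +-cong (*-congˡ (trans (V-suc-suc a 0) (-‿cong (V-zero a)))) (*-congˡ (V-zero (suc a))) ⟩
      - 1# * (- (- U m a)) + m * (- U m (suc a))
        ≈⟨ solve 3 (λ m u₀ u₁ → con -[1+ 0 ] :* (:- (:- u₀)) :+ m :* (:- u₁) := :- (m :* u₁ :+ u₀))
                   refl m (U m a) (U m (suc a)) ⟩
      - U m (suc (suc a)) ∎

    binomialSum-U : ∀ l a K N → a < K →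
      BinomialShift.binomialSum (U m (suc l)) (U m l) (U m) a K N ≈ U m (N +ℕ a *ℕ suc l)
    binomialSum-U l = BinomialShift.binomialSum≈ (U m (suc l)) (U m l) (U m) τ τ₀ τ-suc
      where
        τ : ℕ → ℕ → Carrier
        τ a N = U m (N +ℕ a *ℕ suc l)
        τ₀ : ∀ N → τ 0 N ≈ U m N
        τ₀ N = reflexive (≡.cong (U m) (ℕ.+-identityʳ N))
        τ-suc : ∀ a N → τ (suc a) N ≈ U m (suc l) * τ a (suc N) + U m l * τ a N
        τ-suc a N = trans (reflexive (≡.cong (U m) (regroup N a l))) (U-+ l (N +ℕ a *ℕ suc l))
          where
            regroup : ∀ N a l → N +ℕ suc a *ℕ suc l ≡ (N +ℕ a *ℕ suc l) +ℕ suc l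
            regroup = ℕ-Tactic.solve-∀

    binomialSum-m-1# : ∀ a K N → a < K → BinomialShift.binomialSum m 1# (U m) a K N ≈ U m (N +ℕ (a +ℕ a))
    binomialSum-m-1# = BinomialShift.binomialSum≈ m 1# (U m) τ τ₀ τ-suc
      where
        τ : ℕ → ℕ → Carrier
        τ a N = U m (N +ℕ (a +ℕ a))
        τ₀ : ∀ N → τ 0 N ≈ U m N
        τ₀ N = reflexive (≡.cong (U m) (ℕ.+-identityʳ N))
        τ-suc : ∀ a N → τ (suc a) N ≈ m * τ a (suc N) + 1# * τ a N
        τ-suc a N = trans (reflexive (≡.cong (U m) (regroup N a))) (+-congˡ (sym (*-identityˡ _)))
          where
            regroup : ∀ N a → N +ℕ (suc a +ℕ suc a) ≡ suc (suc (N +ℕ (a +ℕ a)))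
            regroup = ℕ-Tactic.solve-∀

    Σ-alternating≈U : ∀ n i → 1 ≤ i → i ≤ n →
      Σ1 n (λ j → pow (- 1#) ((n +ℕ 1) ∸ j)
                  * (mPowBinom m ((((+ i) +ℤ (+ j)) -ℤ (+ n)) -ℤ (+ 1)) (i ∸ 1) (n ∸ j)
                  * U m (n ∸ j)))
        ≈ U m (i ∸ 1)
    Σ-alternating≈U n (suc a) _ i≤n = begin
      Σ1 n _                                          ≈⟨ Σ1-cong n (λ j _ j≤n → summand≈ j j≤n) ⟩
      Σ1 n (λ j → - 1# * binomialTerm a 0 (n ∸ j))    ≈⟨ Σ1-reverse n (λ t → - 1# * binomialTerm a 0 t) ⟩
      Σ1 n (λ j → - 1# * binomialTerm a 0 (j ∸ 1))    ≈⟨ Σ1-*ˡ n (- 1#) _ ⟩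
      - 1# * binomialSum a n 0                        ≈⟨ *-congˡ (binomialSum≈ V (λ _ → refl) (λ _ _ → refl) a n 0 i≤n) ⟩
      - 1# * V a 0                                    ≈⟨ *-congˡ (V-zero a) ⟩
      - 1# * - U m a                                  ≈⟨ solve 1 (λ u → con -[1+ 0 ] :* (:- u) := u) refl (U m a) ⟩
      U m a                                           ∎
      where
        open BinomialShift (- 1#) m (U m)
        summand≈ : ∀ j → j ≤ n →
          pow (- 1#) ((n +ℕ 1) ∸ j) * (mPowBinom m ((((+ suc a) +ℤ (+ j)) -ℤ (+ n)) -ℤ (+ 1)) a (n ∸ j) * U m (n ∸ j))
            ≈ - 1# * binomialTerm a 0 (n ∸ j)
        summand≈ j j≤n = begin
          pow (- 1#) ((n +ℕ 1) ∸ j) * (mPowBinom m ((((+ suc a) +ℤ (+ j)) -ℤ (+ n)) -ℤ (+ 1)) a t * U m t)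
            ≈⟨ *-cong (reflexive (≡.cong (pow (- 1#)) (≡.trans (ℕ.+-∸-comm 1 j≤n) (ℕ.+-comm t 1))))
                      (*-congʳ (mPowBinom-≈ m (a ∸ t) a t (alternating-exponent j≤n))) ⟩
          (- 1# * pow (- 1#) t) * ((pow m (a ∸ t) * fromℕ (a C t)) * U m t)
            ≈⟨ solve 4 (λ s p c u → (con -[1+ 0 ] :* s) :* ((p :* c) :* u) := con -[1+ 0 ] :* (c :* (s :* (p :* u))))
                       refl (pow (- 1#) t) (pow m (a ∸ t)) (fromℕ (a C t)) (U m t) ⟩
          - 1# * binomialTerm a 0 t ∎
          where t = n ∸ j

    Σ-binomial-m-U-offset : ∀ o a →
      Σ1 (o +ℕ suc a) (λ k → (pow m (a ∸ ((o +ℕ suc a) ∸ k)) * fromℕ (a C ((o +ℕ suc a) ∸ k))) * U m (k ∸ 1))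
        ≈ U m (o +ℕ (a +ℕ a))
    Σ-binomial-m-U-offset o a = begin
      Σ1 (o +ℕ suc a) h                       ≈⟨ Σ1-+ℕ o (suc a) h ⟩
      Σ1 o h + Σ1 (suc a) (λ j → h (o +ℕ j))  ≈⟨ +-cong (Σ1-zero o h≈0) (Σ1-cong (suc a) h≈binomialTerm) ⟩
      0# + binomialSum a (suc a) o            ≈⟨ +-identityˡ _ ⟩
      binomialSum a (suc a) o                 ≈⟨ binomialSum-m-1# a (suc a) o ℕ.≤-refl ⟩
      U m (o +ℕ (a +ℕ a))                     ∎
      where
        open BinomialShift m 1# (U m)
        n = o +ℕ suc a
        h : ℕ → Carrier
        h k = (pow m (a ∸ (n ∸ k)) * fromℕ (a C (n ∸ k))) * U m (k ∸ 1)

        h≈0 : ∀ k → 1 ≤ k → k ≤ o → h k ≈ 0#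
        h≈0 k _ k≤o = trans (*-congʳ (*-congˡ (fromℕ-C-vanish a<n∸k))) (trans (*-congʳ (zeroʳ _)) (zeroˡ _))
          where
            a<n∸k : a < n ∸ k
            a<n∸k = ≡.subst (a <_) (≡.sym (ℕ.+-∸-comm (suc a) k≤o)) (ℕ.m≤n+m (suc a) (o ∸ k))

        h≈binomialTerm : ∀ j → 1 ≤ j → j ≤ suc a → h (o +ℕ j) ≈ binomialTerm a o (j ∸ 1)
        h≈binomialTerm (suc s) _ (s≤s s≤a) = begin
          (pow m (a ∸ (n ∸ (o +ℕ suc s))) * fromℕ (a C (n ∸ (o +ℕ suc s)))) * U m ((o +ℕ suc s) ∸ 1)
            ≈⟨ *-cong (*-cong (reflexive (≡.cong (pow m) a∸[n∸[o+1+s]]≡s)) (reflexive (≡.cong fromℕ aC[n∸[o+1+s]]≡aCs)))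
                      (reflexive (≡.cong (λ k → U m (k ∸ 1)) (ℕ.+-suc o s))) ⟩
          (pow m s * fromℕ (a C s)) * U m (o +ℕ s)
            ≈⟨ *-congˡ (trans (*-congʳ (pow-1# (a ∸ s))) (*-identityˡ _)) ⟨
          (pow m s * fromℕ (a C s)) * (pow 1# (a ∸ s) * U m (o +ℕ s))
            ≈⟨ solve 4 (λ p c q u → (p :* c) :* (q :* u) := c :* (p :* (q :* u))) refl _ _ _ _ ⟩
          binomialTerm a o s ∎
          where
            n∸[o+1+s]≡a∸s : n ∸ (o +ℕ suc s) ≡ a ∸ s
            n∸[o+1+s]≡a∸s = ℕ.[m+n]∸[m+o]≡n∸o o (suc a) (suc s)
            a∸[n∸[o+1+s]]≡s : a ∸ (n ∸ (o +ℕ suc s)) ≡ s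
            a∸[n∸[o+1+s]]≡s = ≡.trans (≡.cong (a ∸_) n∸[o+1+s]≡a∸s) (ℕ.m∸[m∸n]≡n s≤a)
            aC[n∸[o+1+s]]≡aCs : a C (n ∸ (o +ℕ suc s)) ≡ a C s
            aC[n∸[o+1+s]]≡aCs = ≡.trans (≡.cong (a C_) n∸[o+1+s]≡a∸s) (≡.sym (nCk≡nC[n∸k] s≤a))

    Σ-binomial-m-U : ∀ n a → a < n →
      Σ1 n (λ k → (pow m (a ∸ (n ∸ k)) * fromℕ (a C (n ∸ k))) * U m (k ∸ 1)) ≈ U m ((n +ℕ suc a) ∸ 2)
    Σ-binomial-m-U n a a<n with ℕ.m≤n⇒∃[o]m+o≡n a<n
    ... | o , 1+a+o≡n rewrite ≡.sym (≡.trans (ℕ.+-comm o (suc a)) 1+a+o≡n) =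
      trans (Σ-binomial-m-U-offset o a) (reflexive (≡.cong (λ k → U m (k ∸ 2)) (≡.sym (regroup o a))))
      where
        regroup : ∀ o a → o +ℕ suc a +ℕ suc a ≡ 2 +ℕ (o +ℕ (a +ℕ a))
        regroup = ℕ-Tactic.solve-∀

    Σ-doubleAlternating≈U : ∀ n i → 1 ≤ i → i ≤ n →
      Σ1 n (λ j → Σ1 n (λ k →
        pow (- 1#) ((n +ℕ 1) ∸ j)
        * (mPowBinom m ((((+ i) +ℤ (+ j)) +ℤ (+ (2 *ℕ k))) -ℤ (+ ((2 *ℕ n) +ℕ 2))) (i ∸ 1) (n ∸ k)
        * (fromℕ ((k ∸ 1) C (n ∸ j))
        * U m (n ∸ j)))))
        ≈ U m ((n +ℕ i) ∸ 2)
    Σ-doubleAlternating≈U n (suc a) _ i≤n = begin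
      Σ1 n (λ j → Σ1 n (T j))                                                    ≈⟨ Σ1-comm n n T ⟩
      Σ1 n (λ k → Σ1 n (λ j → T j k))                                            ≈⟨ Σ1-cong n inner ⟩
      Σ1 n (λ k → (pow m (a ∸ (n ∸ k)) * fromℕ (a C (n ∸ k))) * U m (k ∸ 1))   ≈⟨ Σ-binomial-m-U n a i≤n ⟩
      U m ((n +ℕ suc a) ∸ 2)                                                     ∎
      where
        T : ℕ → ℕ → Carrier
        T j k = pow (- 1#) ((n +ℕ 1) ∸ j)
          * (mPowBinom m ((((+ suc a) +ℤ (+ j)) +ℤ (+ (2 *ℕ k))) -ℤ (+ ((2 *ℕ n) +ℕ 2))) a (n ∸ k)
          * (fromℕ ((k ∸ 1) C (n ∸ j)) * U m (n ∸ j)))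

        A : ℕ → ℕ → Carrier
        A k j = pow (- 1#) ((n +ℕ 1) ∸ j)
          * (mPowBinom m ((((+ k) +ℤ (+ j)) -ℤ (+ n)) -ℤ (+ 1)) (k ∸ 1) (n ∸ j) * U m (n ∸ j))

        T≈ : ∀ j k → j ≤ n → 1 ≤ k → k ≤ n → T j k ≈ (pow m (a ∸ (n ∸ k)) * fromℕ (a C (n ∸ k))) * A k j
        T≈ j (suc k) j≤n _ k<n = begin
          s * (mPowBinom m Z a (n ∸ suc k) * (fromℕ (k C (n ∸ j)) * u))
            ≈⟨ *-congˡ (sym (*-assoc _ _ _)) ⟩
          s * ((mPowBinom m Z a (n ∸ suc k) * fromℕ (k C (n ∸ j))) * u)
            ≈⟨ *-congˡ (*-congʳ (mPowBinom-*-fromℕ-C m a (n ∸ suc k) k (n ∸ j) (double-exponent j≤n k<n))) ⟩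
          s * ((B * (pow m (k ∸ (n ∸ j)) * fromℕ (k C (n ∸ j)))) * u)
            ≈⟨ solve 4 (λ s B M u → s :* ((B :* M) :* u) := B :* (s :* (M :* u))) refl s B _ u ⟩
          B * (s * ((pow m (k ∸ (n ∸ j)) * fromℕ (k C (n ∸ j))) * u))
            ≈⟨ *-congˡ (*-congˡ (*-congʳ (mPowBinom-≈ m (k ∸ (n ∸ j)) k (n ∸ j) (alternating-exponent j≤n)))) ⟨
          B * A (suc k) j ∎
          where
            s = pow (- 1#) ((n +ℕ 1) ∸ j)
            Z = (((+ suc a) +ℤ (+ j)) +ℤ (+ (2 *ℕ suc k))) -ℤ (+ ((2 *ℕ n) +ℕ 2))
            B = pow m (a ∸ (n ∸ suc k)) * fromℕ (a C (n ∸ suc k))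
            u = U m (n ∸ j)

        inner : ∀ k → 1 ≤ k → k ≤ n →
          Σ1 n (λ j → T j k) ≈ (pow m (a ∸ (n ∸ k)) * fromℕ (a C (n ∸ k))) * U m (k ∸ 1)
        inner k 1≤k k≤n = trans (Σ1-cong n (λ j _ j≤n → T≈ j k j≤n 1≤k k≤n))
                                (trans (Σ1-*ˡ n _ (A k)) (*-congˡ (Σ-alternating≈U n k 1≤k k≤n)))

    Σ-binomialPowers≈U : ∀ n l p → 1 ≤ n → 1 ≤ l →
      Σ1 n (λ j → pow (U m (l ∸ 1)) (n ∸ j) * (pow (U m l) (j ∸ 1)
                  * (U m (((n ∸ 1) *ℕ p) +ℕ (j ∸ 1))
                  * fromℕ ((n ∸ 1) C (j ∸ 1)))))
        ≈ U m ((n ∸ 1) *ℕ (l +ℕ p))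
    Σ-binomialPowers≈U (suc a) (suc l) p _ _ = begin
      Σ1 (suc a) _
        ≈⟨ Σ1-cong (suc a) (λ { (suc t) _ _ →
             solve 4 (λ b α u c → b :* (α :* (u :* c)) := c :* (α :* (b :* u))) refl _ _ _ _ }) ⟩
      binomialSum a (suc a) (a *ℕ p) ≈⟨ binomialSum-U l a (suc a) (a *ℕ p) ℕ.≤-refl ⟩
      U m (a *ℕ p +ℕ a *ℕ suc l)    ≡⟨ ≡.cong (U m) (≡.sym (ℕ.*-distribˡ-+ a p (suc l))) ⟩
      U m (a *ℕ (p +ℕ suc l))        ≡⟨ ≡.cong (λ k → U m (a *ℕ k)) (ℕ.+-comm p (suc l)) ⟩
      U m (a *ℕ (suc l +ℕ p))        ∎
      where open BinomialShift (U m (suc l)) (U m l) (U m)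

    Σ-zpowBinomial≈U : ∀ a l N (α≉0 : ¬ U m (suc l) ≈ 0#) →
      Σ1 (suc (suc a)) (λ j → U m (N +ℕ (j ∸ 1))
                              * (pow (U m l) (suc (suc a) ∸ j)
                              * (zpow (U m (suc l)) α≉0 ((+ j) -ℤ (+ 2)) * fromℕ (binomℤ a ((+ j) -ℤ (+ 2))))))
        ≈ U m (suc N +ℕ a *ℕ suc l)
    Σ-zpowBinomial≈U a l N α≉0 = begin
      Σ1 (suc (suc a)) B                    ≈⟨ Σ1-suc (suc a) B ⟩
      B 1 + Σ1 (suc a) (λ j → B (suc j))    ≈⟨ +-cong B₁≈0 (Σ1-cong (suc a) (λ { (suc t) _ _ → B≈binomialTerm t })) ⟩
      0# + binomialSum a (suc a) (suc N)    ≈⟨ +-identityˡ _ ⟩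
      binomialSum a (suc a) (suc N)         ≈⟨ binomialSum-U l a (suc a) (suc N) ℕ.≤-refl ⟩
      U m (suc N +ℕ a *ℕ suc l)             ∎
      where
        open BinomialShift (U m (suc l)) (U m l) (U m)
        B : ℕ → Carrier
        B j = U m (N +ℕ (j ∸ 1)) * (pow (U m l) (suc (suc a) ∸ j)
              * (zpow (U m (suc l)) α≉0 ((+ j) -ℤ (+ 2)) * fromℕ (binomℤ a ((+ j) -ℤ (+ 2)))))
        -- (+ j) -ℤ (+ 2) reduces to -[1+ 0 ] at j = 1, where binomℤ gives 0, and to + t at j = t + 2.
        B₁≈0 : B 1 ≈ 0#
        B₁≈0 = solve 3 (λ u b z → u :* (b :* (z :* con (+ 0))) := con (+ 0))
                       refl (U m (N +ℕ 0)) (pow (U m l) (suc a)) (inv (U m (suc l)) α≉0 * 1#)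
        B≈binomialTerm : ∀ t → B (suc (suc t)) ≈ binomialTerm a (suc N) t
        B≈binomialTerm t = trans (*-congʳ (reflexive (≡.cong (U m) (ℕ.+-suc N t))))
          (solve 4 (λ u b aᵗ c → u :* (b :* (aᵗ :* c)) := c :* (aᵗ :* (b :* u))) refl _ _ _ _)

    Σ-binomialPowers≈U-suc : ∀ n → 2 ≤ n → (l p : ℕ) → 2 ≤ l → (h : ¬ ((U m (l ∸ 1) * U m l) ≈ 0#)) →
      Σ1 n (λ j → U m (((n ∸ 1) *ℕ p) +ℕ (j ∸ 1))
                  * (zpow (U m (l ∸ 1)) (nz-left (U m (l ∸ 1)) (U m l) h) (((+ n) -ℤ (+ j)) -ℤ (+ 1))
                  * (zpow (U m l) (nz-right (U m (l ∸ 1)) (U m l) h) ((+ j) -ℤ (+ 2))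
                  * ((pow (U m l) 2 * fromℕ ((n ∸ 1) C (j ∸ 1)))
                     + (pow (- 1#) l * fromℕ (binomℤ (n ∸ 2) ((+ j) -ℤ (+ 2))))))))
        ≈ U m (((n ∸ 1) *ℕ (l +ℕ p)) +ℕ 1)
    Σ-binomialPowers≈U-suc n@(suc (suc a)) (s≤s (s≤s z≤n)) (suc (suc l)) p (s≤s (s≤s z≤n)) h =
      *-cancelˡ-nonzero β≉0 (begin
        β * Σ1 n T                         ≈⟨ Σ1-*ˡ n β T ⟨
        Σ1 n (λ j → β * T j)               ≈⟨ Σ1-cong n (λ { (suc i) _ j≤n → clear-zpow α≉0 β≉0 n i j≤n _ _ s _ }) ⟩
        Σ1 n (λ j → α * A j + s * B j)     ≈⟨ trans (Σ1-+ n _ _) (+-cong (Σ1-*ˡ n α A) (Σ1-*ˡ n s B)) ⟩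
        α * Σ1 n A + s * Σ1 n B            ≈⟨ +-cong (*-congˡ (Σ-binomialPowers≈U n (suc (suc l)) p (s≤s z≤n) (s≤s z≤n)))
                                                     (*-congˡ (Σ-zpowBinomial≈U a (suc l) N α≉0)) ⟩
        α * U m (suc a *ℕ (suc (suc l) +ℕ p)) + s * U m Y
                                           ≡⟨ ≡.cong (λ k → α * U m k + s * U m Y) (regroup₁ a l p) ⟩
        α * U m (Y +ℕ suc l) + s * U m Y   ≈⟨ dOcagne (suc l) Y ⟨
        β * U m (Y +ℕ suc (suc l))         ≡⟨ ≡.cong (λ k → β * U m k) (regroup₂ a l p) ⟩
        β * U m (suc a *ℕ (suc (suc l) +ℕ p) +ℕ 1) ∎)
      where
        β = U m (suc l)
        α = U m (suc (suc l))
        β≉0 = nz-left β α h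
        α≉0 = nz-right β α h
        s = pow (- 1#) (suc (suc l))
        N = suc a *ℕ p
        Y = suc N +ℕ a *ℕ suc (suc l)

        T A B : ℕ → Carrier
        T j = U m (N +ℕ (j ∸ 1))
              * (zpow β β≉0 (((+ n) -ℤ (+ j)) -ℤ (+ 1))
              * (zpow α α≉0 ((+ j) -ℤ (+ 2))
              * ((pow α 2 * fromℕ (suc a C (j ∸ 1))) + (s * fromℕ (binomℤ a ((+ j) -ℤ (+ 2)))))))
        A j = pow β (n ∸ j) * (pow α (j ∸ 1) * (U m (N +ℕ (j ∸ 1)) * fromℕ (suc a C (j ∸ 1))))
        B j = U m (N +ℕ (j ∸ 1)) * (pow β (n ∸ j) * (zpow α α≉0 ((+ j) -ℤ (+ 2)) * fromℕ (binomℤ a ((+ j) -ℤ (+ 2)))))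

        regroup₁ : ∀ a l p → suc a *ℕ (suc (suc l) +ℕ p) ≡ (suc (suc a *ℕ p) +ℕ a *ℕ suc (suc l)) +ℕ suc l
        regroup₁ = ℕ-Tactic.solve-∀
        regroup₂ : ∀ a l p → (suc (suc a *ℕ p) +ℕ a *ℕ suc (suc l)) +ℕ suc (suc l)
                             ≡ suc a *ℕ (suc (suc l) +ℕ p) +ℕ 1
        regroup₂ = ℕ-Tactic.solve-∀

corollary3p5 : {c ℓ : Level} (F : Field c ℓ) (m : Field.Carrier F) (n : ℕ) → 1 ≤ n →
  let open Field F in
  let open FieldDefs F in
  -- (1)
  ((i : ℕ) → 1 ≤ i → i ≤ n →
    Σ1 n (λ j → pow (- 1#) ((n +ℕ 1) ∸ j)
                * (mPowBinom m ((((+ i) +ℤ (+ j)) -ℤ (+ n)) -ℤ (+ 1)) (i ∸ 1) (n ∸ j)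
                * U m (n ∸ j)))
      ≈ U m (i ∸ 1))
  ×
  -- (2)
  ((i : ℕ) → 1 ≤ i → i ≤ n →
    Σ1 n (λ j → Σ1 n (λ k →
      pow (- 1#) ((n +ℕ 1) ∸ j)
      * (mPowBinom m ((((+ i) +ℤ (+ j)) +ℤ (+ (2 *ℕ k))) -ℤ (+ ((2 *ℕ n) +ℕ 2))) (i ∸ 1) (n ∸ k)
      * (fromℕ ((k ∸ 1) C (n ∸ j))
      * U m (n ∸ j)))))
      ≈ U m ((n +ℕ i) ∸ 2))
  ×
  -- (3)
  ((l p : ℕ) → 1 ≤ l →
    Σ1 n (λ j → pow (U m (l ∸ 1)) (n ∸ j) * (pow (U m l) (j ∸ 1)
                * (U m (((n ∸ 1) *ℕ p) +ℕ (j ∸ 1))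
                * fromℕ ((n ∸ 1) C (j ∸ 1)))))
      ≈ U m ((n ∸ 1) *ℕ (l +ℕ p)))
  ×
  -- (4)
  (2 ≤ n → (l p : ℕ) → 2 ≤ l → (h : ¬ ((U m (l ∸ 1) * U m l) ≈ 0#)) →
    Σ1 n (λ j → U m (((n ∸ 1) *ℕ p) +ℕ (j ∸ 1))
                * (zpow (U m (l ∸ 1)) (nz-left (U m (l ∸ 1)) (U m l) h) (((+ n) -ℤ (+ j)) -ℤ (+ 1))
                * (zpow (U m l) (nz-right (U m (l ∸ 1)) (U m l) h) ((+ j) -ℤ (+ 2))
                * ((pow (U m l) 2 * fromℕ ((n ∸ 1) C (j ∸ 1)))
                   + (pow (- 1#) l * fromℕ (binomℤ (n ∸ 2) ((+ j) -ℤ (+ 2))))))))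
      ≈ U m (((n ∸ 1) *ℕ (l +ℕ p)) +ℕ 1))
corollary3p5 F m n 1≤n =
    Σ-alternating≈U n
  , Σ-doubleAlternating≈U n
  , (λ l p 1≤l → Σ-binomialPowers≈U n l p 1≤n 1≤l)
  , Σ-binomialPowers≈U-suc n
  where open LucasSequence F m
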